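{- Let $3 \leq p \leq q$ be integers. Then the quadratic equation $x^2 - (q+3)x + (pq+2) = 0$ has two integral roots $p'', q'' \in [2,\infty)$ if and only if there exist nonnegative integers $a, b, b', t$ with $1 \leq b, b' < a$, $\gcd(a,b) = 1$, $bb' \equiv 1 \pmod a$, and $bb' + t \geq 2$ such that $$p = b(a-b)t + bb' + \frac{b(1-bb')}{a} + 1,\qquad q = a^2 t + ab',$$ $$p'' = \frac{bq}{a} + 1,\qquad q'' = q + 2 - \frac{bq}{a}.$$ -}

module Defs where

open import Data.Integer using (ℤ; _+_; _-_; _*_)
open import Relation.Binary.PropositionalEquality using (_≡_)

HasRoots : ℤ → ℤ → ℤ → ℤ → Set
HasRoots p q r₁ r₂ =
  ∀ (x : ℤ) → x * x - (q + ℤ.pos 3) * x + (p * q + ℤ.pos 2) ≡ (x - r₁) * (x - r₂)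

-- By Vieta, p″ and q″ are the roots exactly when q″ = q + 3 - p″ and
-- (p″ - 1)(p″ - 2) = (p″ - p) q.  Put g = gcd (p″ - 1, q) and write p″ - 1 = b g, q = a g with
-- a, b coprime; cancelling g leaves b (b g - 1) = (b g + 1 - p) a.  So a divides b g - 1, and
-- dividing g by a as g = b′ + t a turns this into a ∣ b b′ - 1 and into the formula for p, while
-- p″ - 1 = b g and q″ = q + 2 - b g give the formulas for p″ and q″.  Every one of these steps
-- is reversible.  Of the side conditions, b ≤ a comes from q″ ≥ 2, b′ ≥ 1 holds because a > 1
-- does not divide -1, and b = a (forcing a = b = 1) or b = b′ = 1, t = 0 would give p = 2.
module Submission where

open import Defs
open import Data.Integer using (ℤ; _+_; _-_; _*_; _≤_; _<_; +_)
open import Data.Integer.Divisibility using (_∣_)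
open import Data.Integer.GCD using (gcd)
open import Data.Product using (_×_; ∃-syntax)
open import Function.Bundles using (_⇔_)
open import Relation.Binary.PropositionalEquality using (_≡_)

open import Data.Empty using (⊥-elim)
open import Data.Integer using (-_; +≤+; +<+; NonZero; >-nonZero; nonNegative)
open import Data.Integer.Properties
  using (i≡j⇒i-j≡0; i-j≡0⇒i≡j; *-cancelˡ-≡; *-zeroʳ; pos-+; pos-*; +-injective; drop‿+≤+;
         +-monoʳ-≤; neg-mono-≤; ≤-<-trans; <-≤-trans; +-mono-<-≤; *-monoʳ-≤-nonNeg; module ≤-Reasoning)
import Data.Integer.Coprimality as ℤ
import Data.Integer.Divisibility.Signed as Signed
open import Data.Integer.Tactic.RingSolver using (solve)
open import Data.List using (_∷_; [])
import Data.Nat as ℕ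
open ℕ using (ℕ; suc; z≤n; s≤s)
import Data.Nat.Properties as ℕ
open import Data.Nat.Coprimality as Coprime using (Coprime; GCD≡1⇒coprime; coprime⇒gcd≡1)
open import Data.Nat.Divisibility using (divides; ∣-refl; ∣-reflexive; ∣1⇒≡1)
open import Data.Nat.DivMod using (_%_; _/_; m≡m%n+[m/n]*n; m%n<n)
open import Data.Nat.GCD using (GCD; gcd-GCD; GCD-*; gcd[m,n]∣m; gcd[m,n]∣n; gcd[m,n]≢0)
import Data.Nat.GCD as ℕ
open import Data.Product using (_,_; proj₁; proj₂)
open import Data.Sum using (_⊎_; inj₁; inj₂)
open import Function.Bundles using (mk⇔; Equivalence)
open import Relation.Binary.PropositionalEquality
  using (_≢_; refl; sym; trans; cong; cong₂; subst; subst₂; module ≡-Reasoning)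
open import Relation.Nullary using (¬_)

≡⇔≡-by-difference : ∀ {x y z w : ℤ} c .{{_ : NonZero c}} →
                    x - y ≡ c * (z - w) → x ≡ y ⇔ z ≡ w
≡⇔≡-by-difference {x} {y} {z} {w} c x-y≡c[z-w] = mk⇔ to from
  where
  open ≡-Reasoning
  to : x ≡ y → z ≡ w
  to x≡y = i-j≡0⇒i≡j z w (*-cancelˡ-≡ c (z - w) (+ 0) (begin
    c * (z - w) ≡⟨ sym x-y≡c[z-w] ⟩
    x - y       ≡⟨ i≡j⇒i-j≡0 x≡y ⟩
    + 0         ≡⟨ sym (*-zeroʳ c) ⟩
    c * + 0     ∎))
  from : z ≡ w → x ≡ y
  from z≡w = i-j≡0⇒i≡j x y (begin
    x - y       ≡⟨ x-y≡c[z-w] ⟩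
    c * (z - w) ≡⟨ cong (c *_) (i≡j⇒i-j≡0 z≡w) ⟩
    c * + 0     ≡⟨ *-zeroʳ c ⟩
    + 0         ∎)

factorisation⇔vieta : ∀ s t r₁ r₂ →
  (∀ x → x * x - s * x + t ≡ (x - r₁) * (x - r₂)) ⇔ (r₁ + r₂ ≡ s × r₁ * r₂ ≡ t)
factorisation⇔vieta s t r₁ r₂ = mk⇔ to from
  where
  open ≡-Reasoning
  to : (∀ x → x * x - s * x + t ≡ (x - r₁) * (x - r₂)) → r₁ + r₂ ≡ s × r₁ * r₂ ≡ t
  to factors = sum , product
    where
    product : r₁ * r₂ ≡ t
    product = begin
      r₁ * r₂                      ≡⟨ solve (r₁ ∷ r₂ ∷ []) ⟩
      (+ 0 - r₁) * (+ 0 - r₂)      ≡⟨ sym (factors (+ 0)) ⟩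
      + 0 * + 0 - s * + 0 + t      ≡⟨ solve (s ∷ t ∷ []) ⟩
      t                            ∎
    sum : r₁ + r₂ ≡ s
    sum = begin
      r₁ + r₂                                      ≡⟨ solve (r₁ ∷ r₂ ∷ []) ⟩
      + 1 + r₁ * r₂ - (+ 1 - r₁) * (+ 1 - r₂)
        ≡⟨ cong₂ (λ u v → + 1 + u - v) product (sym (factors (+ 1))) ⟩
      + 1 + t - (+ 1 * + 1 - s * + 1 + t)          ≡⟨ solve (s ∷ t ∷ []) ⟩
      s                                            ∎
  from : r₁ + r₂ ≡ s × r₁ * r₂ ≡ t → ∀ x → x * x - s * x + t ≡ (x - r₁) * (x - r₂)
  from (refl , refl) x = solve (x ∷ r₁ ∷ r₂ ∷ [])

RootRelation : ℤ → ℤ → ℤ → ℤ → Set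
RootRelation p q r s = q + + 3 - r ≡ s × (r - + 1) * (r - + 2) ≡ (r - p) * q

product⇔root-relation : ∀ p q r {s} → q + + 3 - r ≡ s →
  r * s ≡ p * q + + 2 ⇔ (r - + 1) * (r - + 2) ≡ (r - p) * q
product⇔root-relation p q r refl = ≡⇔≡-by-difference (- + 1) difference
  where
  difference : r * (q + + 3 - r) - (p * q + + 2) ≡ - + 1 * ((r - + 1) * (r - + 2) - (r - p) * q)
  difference = solve (p ∷ q ∷ r ∷ [])

hasRoots⇔rootRelation : ∀ p q r s → HasRoots p q r s ⇔ RootRelation p q r s
hasRoots⇔rootRelation p q r s = mk⇔ to from
  where
  vieta : HasRoots p q r s ⇔ (r + s ≡ q + + 3 × r * s ≡ p * q + + 2)
  vieta = factorisation⇔vieta (q + + 3) (p * q + + 2) r s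
  sum⇔ : r + s ≡ q + + 3 ⇔ q + + 3 - r ≡ s
  sum⇔ = ≡⇔≡-by-difference (- + 1) difference
    where
    difference : r + s - (q + + 3) ≡ - + 1 * (q + + 3 - r - s)
    difference = solve (q ∷ r ∷ s ∷ [])
  to : HasRoots p q r s → RootRelation p q r s
  to roots =
    let sum , product = Equivalence.to vieta roots
        s≡ = Equivalence.to sum⇔ sum
    in s≡ , Equivalence.to (product⇔root-relation p q r s≡) product
  from : RootRelation p q r s → HasRoots p q r s
  from (s≡ , relation) = Equivalence.from vieta
    (Equivalence.from sum⇔ s≡ , Equivalence.from (product⇔root-relation p q r s≡) relation)

CofactorRelation : ℤ → ℤ → ℤ → ℤ → Set
CofactorRelation p a b g = b * (b * g - + 1) ≡ (b * g + + 1 - p) * a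

rootRelation⇔cofactorRelation : ∀ p a b g .{{_ : NonZero g}} {q r} → r ≡ + 1 + b * g → q ≡ a * g →
  (r - + 1) * (r - + 2) ≡ (r - p) * q ⇔ CofactorRelation p a b g
rootRelation⇔cofactorRelation p a b g refl refl = ≡⇔≡-by-difference g difference
  where
  difference : (+ 1 + b * g - + 1) * (+ 1 + b * g - + 2) - (+ 1 + b * g - p) * (a * g)
             ≡ g * (b * (b * g - + 1) - (b * g + + 1 - p) * a)
  difference = solve (p ∷ a ∷ b ∷ g ∷ [])

cofactorRelation⇔p-formula : ∀ p a b b′ t →
  CofactorRelation p a b (b′ + t * a) ⇔ a * p ≡ a * (b * (a - b) * t + b * b′ + + 1) + b * (+ 1 - b * b′)
cofactorRelation⇔p-formula p a b b′ t = ≡⇔≡-by-difference (+ 1) difference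
  where
  difference : b * (b * (b′ + t * a) - + 1) - (b * (b′ + t * a) + + 1 - p) * a
             ≡ + 1 * (a * p - (a * (b * (a - b) * t + b * b′ + + 1) + b * (+ 1 - b * b′)))
  difference = solve (p ∷ a ∷ b ∷ b′ ∷ t ∷ [])

p-formula⇒p≡2 : ∀ p a b b′ t .{{_ : NonZero a}} →
  a * p ≡ a * (b * (a - b) * t + b * b′ + + 1) + b * (+ 1 - b * b′) →
  (a ≡ + 1 × b ≡ + 1) ⊎ (b ≡ + 1 × b′ ≡ + 1 × t ≡ + 0) → p ≡ + 2
p-formula⇒p≡2 p a b b′ t formula (inj₁ (refl , refl)) = begin
  p                                                                        ≡⟨ solve (p ∷ []) ⟩
  + 1 * p                                                                  ≡⟨ formula ⟩
  + 1 * (+ 1 * (+ 1 - + 1) * t + + 1 * b′ + + 1) + + 1 * (+ 1 - + 1 * b′)  ≡⟨ solve (b′ ∷ t ∷ []) ⟩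
  + 2                                                                      ∎
  where open ≡-Reasoning
p-formula⇒p≡2 p a b b′ t formula (inj₂ (refl , refl , refl)) = *-cancelˡ-≡ a p (+ 2) (begin
  a * p                                                                    ≡⟨ formula ⟩
  a * (+ 1 * (a - + 1) * + 0 + + 1 * + 1 + + 1) + + 1 * (+ 1 - + 1 * + 1)  ≡⟨ solve (a ∷ []) ⟩
  a * + 2                                                                  ∎)
  where open ≡-Reasoning

cofactorRelation⇒∣ : ∀ p a b b′ t → ℤ.Coprime a b →
  CofactorRelation p a b (b′ + t * a) → a ∣ b * b′ - + 1
cofactorRelation⇒∣ p a b b′ t coprime relation =
  Signed.∣⇒∣ᵤ (Signed.∣m+n∣n⇒∣m {m = b * b′ - + 1} a∣bb′-1+bta (Signed.divides (b * t) refl))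
  where
  a∣bg-1 : a ∣ b * (b′ + t * a) - + 1
  a∣bg-1 = ℤ.coprime-divisor a b (b * (b′ + t * a) - + 1) coprime
             (Signed.∣⇒∣ᵤ (Signed.divides (b * (b′ + t * a) + + 1 - p) relation))
  bg-1≡bb′-1+bta : b * (b′ + t * a) - + 1 ≡ (b * b′ - + 1) + b * t * a
  bg-1≡bb′-1+bta = solve (a ∷ b ∷ b′ ∷ t ∷ [])
  a∣bb′-1+bta : a Signed.∣ (b * b′ - + 1) + b * t * a
  a∣bb′-1+bta = subst (a Signed.∣_) bg-1≡bb′-1+bta (Signed.∣ᵤ⇒∣ a∣bg-1)

roots⇔cofactors : ∀ r s a b g .{{_ : NonZero a}} {q} → q ≡ a * g →
  (a * (r - + 1) ≡ b * q × a * (q + + 2 - s) ≡ b * q) ⇔ (r ≡ + 1 + b * g × q + + 3 - r ≡ s)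
roots⇔cofactors r s a b g refl = mk⇔ to from
  where
  r⇔ : a * (r - + 1) ≡ b * (a * g) ⇔ r ≡ + 1 + b * g
  r⇔ = ≡⇔≡-by-difference a difference
    where
    difference : a * (r - + 1) - b * (a * g) ≡ a * (r - (+ 1 + b * g))
    difference = solve (r ∷ a ∷ b ∷ g ∷ [])
  s⇔ : r ≡ + 1 + b * g → a * (a * g + + 2 - s) ≡ b * (a * g) ⇔ a * g + + 3 - r ≡ s
  s⇔ refl = ≡⇔≡-by-difference a difference
    where
    difference : a * (a * g + + 2 - s) - b * (a * g) ≡ a * (a * g + + 3 - (+ 1 + b * g) - s)
    difference = solve (s ∷ a ∷ b ∷ g ∷ [])
  to : a * (r - + 1) ≡ b * (a * g) × a * (a * g + + 2 - s) ≡ b * (a * g) →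
       r ≡ + 1 + b * g × a * g + + 3 - r ≡ s
  to (r-eq , s-eq) = let r≡ = Equivalence.to r⇔ r-eq in r≡ , Equivalence.to (s⇔ r≡) s-eq
  from : r ≡ + 1 + b * g × a * g + + 3 - r ≡ s →
         a * (r - + 1) ≡ b * (a * g) × a * (a * g + + 2 - s) ≡ b * (a * g)
  from (r≡ , s≡) = Equivalence.from r⇔ r≡ , Equivalence.from (s⇔ r≡) s≡

a*[b′+ta]≡a*a*t+a*b′ : ∀ a b′ t → a * (b′ + t * a) ≡ a * a * t + a * b′
a*[b′+ta]≡a*a*t+a*b′ a b′ t = solve (a ∷ b′ ∷ t ∷ [])

record CoprimeCofactors (m n g : ℕ) : Set where
  field
    m′ n′   : ℕ
    m≡m′*g  : m ≡ m′ ℕ.* g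
    n≡n′*g  : n ≡ n′ ℕ.* g
    coprime : Coprime n′ m′

coprime-cofactors : ∀ m n .{{_ : ℕ.NonZero n}} → CoprimeCofactors m n (ℕ.gcd m n)
coprime-cofactors m n with gcd[m,n]∣m m n | gcd[m,n]∣n m n
... | divides m′ m≡m′g | divides n′ n≡n′g = record
  { m′ = m′ ; n′ = n′ ; m≡m′*g = m≡m′g ; n≡n′*g = n≡n′g
  ; coprime = Coprime.sym (GCD≡1⇒coprime (GCD-* gcd[m′g,n′g]))
  }
  where
  g : ℕ
  g = ℕ.gcd m n
  instance
    g≢0 : ℕ.NonZero g
    g≢0 = ℕ.≢-nonZero (gcd[m,n]≢0 m n (inj₂ (ℕ.≢-nonZero⁻¹ n)))
  gcd[m′g,n′g] : GCD (m′ ℕ.* g) (n′ ℕ.* g) (1 ℕ.* g)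
  gcd[m′g,n′g] = subst₂ (λ x y → GCD x y (1 ℕ.* g)) m≡m′g n≡n′g
                   (subst (GCD m n) (sym (ℕ.*-identityˡ g)) (gcd-GCD m n))

2≤m*n+o : ∀ {m n o} → 1 ℕ.≤ m → 1 ℕ.≤ n → ¬ (m ≡ 1 × n ≡ 1 × o ≡ 0) → 2 ℕ.≤ m ℕ.* n ℕ.+ o
2≤m*n+o {suc m} {suc n} {suc o} _ _ _ =
  ℕ.+-mono-≤ (ℕ.*-mono-≤ (s≤s (z≤n {m})) (s≤s (z≤n {n}))) (s≤s (z≤n {o}))
2≤m*n+o {1} {1} {0} _ _ ¬degenerate = ⊥-elim (¬degenerate (refl , refl , refl))
2≤m*n+o {suc (suc m)} {suc n} {0} _ _ _ =
  ℕ.≤-trans (ℕ.*-mono-≤ (s≤s (s≤s (z≤n {m}))) (s≤s (z≤n {n}))) (ℕ.m≤m+n _ 0)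
2≤m*n+o {1} {suc (suc n)} {0} _ _ _ =
  ℕ.≤-trans (ℕ.*-mono-≤ (s≤s (z≤n {0})) (s≤s (s≤s (z≤n {n})))) (ℕ.m≤m+n _ 0)

Parametrisation : ℤ → ℤ → ℤ → ℤ → Set
Parametrisation p q p″ q″ =
  ∃[ a ] ∃[ b ] ∃[ b′ ] ∃[ t ]
    (+ 0 ≤ a × + 0 ≤ b × + 0 ≤ b′ × + 0 ≤ t ×
     + 1 ≤ b × b < a × + 1 ≤ b′ × b′ < a ×
     gcd a b ≡ + 1 × a ∣ (b * b′ - + 1) × + 2 ≤ b * b′ + t ×
     a * p ≡ a * (b * (a - b) * t + b * b′ + + 1) + b * (+ 1 - b * b′) ×
     q ≡ a * a * t + a * b′ ×
     a * (p″ - + 1) ≡ b * q ×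
     a * (q + + 2 - q″) ≡ b * q)

parametrisation⇒rootRelation : ∀ p q p″ q″ → Parametrisation p q p″ q″ → RootRelation p q p″ q″
parametrisation⇒rootRelation p q p″ q″
  (a , b , b′ , t , 0≤a , 0≤b , _ , 0≤t , _ , b<a , 1≤b′ , _ , _ , _ , _ , p-formula , q≡ , p″eq , q″eq) =
  let p″≡ , q″≡ = Equivalence.to (roots⇔cofactors p″ q″ a b (b′ + t * a) {{a≢0}} q≡ag)
                                 (p″eq , q″eq)
  in q″≡ , Equivalence.from (rootRelation⇔cofactorRelation p a b (b′ + t * a) {{g≢0}} p″≡ q≡ag)
             (Equivalence.from (cofactorRelation⇔p-formula p a b b′ t) p-formula)
  where
  q≡ag : q ≡ a * (b′ + t * a)
  q≡ag = trans q≡ (sym (a*[b′+ta]≡a*a*t+a*b′ a b′ t))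
  a≢0 : NonZero a
  a≢0 = >-nonZero (≤-<-trans 0≤b b<a)
  g≢0 : NonZero (b′ + t * a)
  g≢0 = >-nonZero (+-mono-<-≤ (<-≤-trans (+<+ (s≤s z≤n)) 1≤b′)
                               (*-monoʳ-≤-nonNeg a {{nonNegative 0≤a}} 0≤t))

root-bound : ∀ q r {s} → + 2 ≤ s → q + + 3 - r ≡ s → r - + 1 ≤ q
root-bound q r 2≤s refl = begin
  r - + 1                  ≡⟨ solve (q ∷ r ∷ []) ⟩
  q + + 2 - (q + + 3 - r)  ≤⟨ +-monoʳ-≤ (q + + 2) (neg-mono-≤ 2≤s) ⟩
  q + + 2 - + 2            ≡⟨ solve (q ∷ []) ⟩
  q                        ∎
  where open ≤-Reasoning

module Parametrise {P Q M : ℕ} .{{_ : ℕ.NonZero Q}} {q″ : ℤ}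
  (3≤P : 3 ℕ.≤ P) (1≤M : 1 ℕ.≤ M) (M≤Q : M ℕ.≤ Q)
  (rootRelation : RootRelation (+ P) (+ Q) (+ suc M) q″)
  where

  g : ℕ
  g = ℕ.gcd M Q

  open CoprimeCofactors (coprime-cofactors M Q)
    renaming (m′ to b; n′ to a; m≡m′*g to M≡bg; n≡n′*g to Q≡ag)

  ag≢0 : ℕ.NonZero (a ℕ.* g)
  ag≢0 = ℕ.≢-nonZero (λ ag≡0 → ℕ.≢-nonZero⁻¹ Q (trans Q≡ag ag≡0))

  instance
    a≢0 : ℕ.NonZero a
    a≢0 = ℕ.m*n≢0⇒m≢0 a {{ag≢0}}
    g≢0 : ℕ.NonZero g
    g≢0 = ℕ.m*n≢0⇒n≢0 a {{ag≢0}}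

  b′ t : ℕ
  b′ = g % a
  t = g / a

  g≡b′+ta : + g ≡ + b′ + + t * + a
  g≡b′+ta = trans (cong +_ (m≡m%n+[m/n]*n g a))
              (trans (pos-+ b′ (t ℕ.* a)) (cong (_+_ (+ b′)) (pos-* t a)))

  p″≡1+bg : + suc M ≡ + 1 + + b * + g
  p″≡1+bg = trans (pos-+ 1 M) (cong (_+_ (+ 1)) (trans (cong +_ M≡bg) (pos-* b g)))

  q≡ag : + Q ≡ + a * + g
  q≡ag = trans (cong +_ Q≡ag) (pos-* a g)

  cofactorRelation : CofactorRelation (+ P) (+ a) (+ b) (+ b′ + + t * + a)
  cofactorRelation = subst (CofactorRelation (+ P) (+ a) (+ b)) g≡b′+ta
    (Equivalence.to (rootRelation⇔cofactorRelation (+ P) (+ a) (+ b) (+ g) p″≡1+bg q≡ag)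
                    (proj₂ rootRelation))

  p-formula : + a * + P ≡ + a * (+ b * (+ a - + b) * + t + + b * + b′ + + 1) + + b * (+ 1 - + b * + b′)
  p-formula =
    Equivalence.to (cofactorRelation⇔p-formula (+ P) (+ a) (+ b) (+ b′) (+ t)) cofactorRelation

  q-formula : + Q ≡ + a * + a * + t + + a * + b′
  q-formula =
    trans q≡ag (trans (cong (_*_ (+ a)) g≡b′+ta) (a*[b′+ta]≡a*a*t+a*b′ (+ a) (+ b′) (+ t)))

  p″q″-formulas : + a * (+ suc M - + 1) ≡ + b * + Q × + a * (+ Q + + 2 - q″) ≡ + b * + Q
  p″q″-formulas = Equivalence.from (roots⇔cofactors (+ suc M) q″ (+ a) (+ b) (+ g) q≡ag)
                    (p″≡1+bg , proj₁ rootRelation)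

  a∣bb′-1 : + a ∣ + b * + b′ - + 1
  a∣bb′-1 = cofactorRelation⇒∣ (+ P) (+ a) (+ b) (+ b′) (+ t) coprime cofactorRelation

  P≢2 : + P ≢ + 2
  P≢2 P≡2 = ℕ.<⇒≢ 3≤P (sym (+-injective P≡2))

  degenerate⇒P≡2 : (+ a ≡ + 1 × + b ≡ + 1) ⊎ (+ b ≡ + 1 × + b′ ≡ + 1 × + t ≡ + 0) → + P ≡ + 2
  degenerate⇒P≡2 = p-formula⇒p≡2 (+ P) (+ a) (+ b) (+ b′) (+ t) p-formula

  1≤b : 1 ℕ.≤ b
  1≤b = ℕ.>-nonZero⁻¹ b {{ℕ.m*n≢0⇒m≢0 b {{subst ℕ.NonZero M≡bg (ℕ.>-nonZero 1≤M)}}}}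

  b<a : b ℕ.< a
  b<a = ℕ.≤∧≢⇒< (ℕ.*-cancelʳ-≤ b a g (subst₂ ℕ._≤_ M≡bg Q≡ag M≤Q)) b≢a
    where
    b≢a : b ≢ a
    b≢a b≡a = P≢2 (degenerate⇒P≡2 (inj₁ (cong +_ a≡1 , cong +_ (trans b≡a a≡1))))
      where
      a≡1 : a ≡ 1
      a≡1 = coprime (∣-refl , ∣-reflexive (sym b≡a))

  1≤b′ : 1 ℕ.≤ b′
  1≤b′ = ℕ.n≢0⇒n>0 b′≢0
    where
    b′≢0 : b′ ≢ 0
    b′≢0 b′≡0 = ℕ.≤⇒≯ 1≤b (subst (b ℕ.<_) a≡1 b<a)
      where
      a≡1 : a ≡ 1
      a≡1 = ∣1⇒≡1 (subst (λ x → + a ∣ x - + 1)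
                          (trans (cong (λ x → + b * + x) b′≡0) (*-zeroʳ (+ b))) a∣bb′-1)

  2≤bb′+t : + 2 ≤ + b * + b′ + + t
  2≤bb′+t = subst (+ 2 ≤_) (trans (pos-+ (b ℕ.* b′) t) (cong (_+ + t) (pos-* b b′)))
    (+≤+ (2≤m*n+o 1≤b 1≤b′ λ (b≡1 , b′≡1 , t≡0) →
      P≢2 (degenerate⇒P≡2 (inj₂ (cong +_ b≡1 , cong +_ b′≡1 , cong +_ t≡0)))))

  parametrisation : Parametrisation (+ P) (+ Q) (+ suc M) q″
  parametrisation =
    + a , + b , + b′ , + t , +≤+ z≤n , +≤+ z≤n , +≤+ z≤n , +≤+ z≤n ,
    +≤+ 1≤b , +<+ b<a , +≤+ 1≤b′ , +<+ (m%n<n g a) ,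
    cong +_ (coprime⇒gcd≡1 coprime) , a∣bb′-1 , 2≤bb′+t ,
    p-formula , q-formula , proj₁ p″q″-formulas , proj₂ p″q″-formulas

lemma4p2 : ∀ (p q p″ q″ : ℤ) → + 3 ≤ p → p ≤ q → + 2 ≤ p″ → + 2 ≤ q″ →
    HasRoots p q p″ q″ ⇔
    (∃[ a ] ∃[ b ] ∃[ b′ ] ∃[ t ]
      (+ 0 ≤ a × + 0 ≤ b × + 0 ≤ b′ × + 0 ≤ t ×
       + 1 ≤ b × b < a × + 1 ≤ b′ × b′ < a ×
       gcd a b ≡ + 1 × a ∣ (b * b′ - + 1) × + 2 ≤ b * b′ + t ×
       a * p ≡ a * (b * (a - b) * t + b * b′ + + 1) + b * (+ 1 - b * b′) ×
       q ≡ a * a * t + a * b′ ×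
       a * (p″ - + 1) ≡ b * q ×
       a * (q + + 2 - q″) ≡ b * q))
-- p ≤ q is only needed to make q, and hence gcd (p″ - 1, q), nonzero.
lemma4p2 p q p″ q″ (+≤+ 3≤P@(s≤s _)) (+≤+ (s≤s _)) (+≤+ (s≤s 1≤M)) 2≤q″ = mk⇔
  (λ roots → let root@(q″≡ , _) = Equivalence.to roots⇔ roots in
             Parametrise.parametrisation 3≤P 1≤M (drop‿+≤+ (root-bound q p″ 2≤q″ q″≡)) root)
  (λ parameters → Equivalence.from roots⇔ (parametrisation⇒rootRelation p q p″ q″ parameters))
  where
  roots⇔ : HasRoots p q p″ q″ ⇔ RootRelation p q p″ q″
  roots⇔ = hasRoots⇔rootRelation p q p″ q″
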